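{- If $(\mathcal T,\mathcal T')$ is a pair of standard tableaux of type $D_j(i)$ for some $i,j$, then $\digamma(\mathcal T)=q\,\digamma(\mathcal T')$.
   Context: Tableaux: a tableau $(\lambda,w)$ is the diagram of $\lambda$ (French convention, rows from the bottom) filled with the letters of the word $w$ left to right, top row first; $w$ is the reading word. Standard: rows increasing left to right, columns increasing upward, letters $1,\dots,n$ each once. $T_S$ is the subword of the reading word consisting of letters in $S$. cocharge of a standard word $w$ of length $n$: $c_1=0$, $c_{i+1}=c_i+1$ if $i+1$ lies to the left of $i$ in $w$, else $c_{i+1}=c_i$; cocharge $=c_1+\dots+c_n$. $\digamma(\mathcal T)=q^{\mathrm{cocharge}(\mathcal T)}S_{\mathrm{shape}(\mathcal T)}[X^t]$, with $S_\lambda$ Schur functions and $X^t=(x_1+\dots+x_N)(t-1)$ in plethystic notation. Pair types: for a letter $a$, put $b=a+1,c=a+2,d=a+3$ and $D_1(a)=(bacd,cabd)$, $D_2(a)=(dbac,dcab)$, $D_3(a)=(acdb,abdc)$, $D_4(a)=(cdba,bdca)$. A pair $(T_1,T_2)$ of semi-standard tableaux is of type $D_j(a)$ if $T_1$ is obtained from $T_2$ by interchanging the letters $b$ and $c$ (same shape) and $(T_{1,\{a,b,c,d\}},T_{2,\{a,b,c,d\}})=D_j(a)$. -}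

module Defs where

open import Data.Bool using (Bool; true; false; if_then_else_; _∧_; _∨_; not)
open import Data.Nat as ℕ using (ℕ; zero; suc; _+_; _<_; _≤_; _≥_; _<ᵇ_; _≡ᵇ_)
open import Data.Integer as ℤ using (ℤ; +_; -_) renaming (_*_ to _*ℤ_; _+_ to _+ℤ_)
open import Data.Fin using (Fin; zero; suc)
open import Data.Fin.Properties using () renaming (_≟_ to _≟F_)
open import Data.List using (List; []; _∷_; _++_; map; concatMap; foldr; length;
  take; drop; reverse; upTo; allFin)
open import Data.Nat.ListAction using (sum)
open import Data.List.Relation.Unary.All using (All)
open import Data.List.Relation.Unary.Linked using (Linked)
open import Data.List.Relation.Binary.Permutation.Propositional using (_↭_)
open import Data.Vec using (Vec; replicate; updateAt)
open import Data.Vec.Properties using (≡-dec)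
open import Data.Nat.Properties using () renaming (_≟_ to _≟ℕ_)
open import Data.Product using (_×_; _,_; proj₁; proj₂)
open import Data.Unit using (⊤)
open import Data.Empty using (⊥)
open import Relation.Binary.PropositionalEquality using (_≡_)
open import Relation.Nullary using (does)

boolFilter : {A : Set} → (A → Bool) → List A → List A
boolFilter p []       = []
boolFilter p (x ∷ xs) = if p x then x ∷ boolFilter p xs else boolFilter p xs

-- Tableaux  (λ , w) : shape λ (row lengths, bottom row first) and
-- reading word w (top row first, each row read left to right).

record Tableau : Set where
  constructor tab
  field
    shape : List ℕ
    word  : List ℕ
open Tableau public

split : List ℕ → List ℕ → List (List ℕ)
split []       w = []
split (l ∷ ls) w = take l w ∷ split ls (drop l w)

rows : Tableau → List (List ℕ)
rows T = reverse (split (reverse (shape T)) (word T))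

IsPartition : List ℕ → Set
IsPartition la = All (λ k → 1 ≤ k) la × Linked _≥_ la

ColInc : List ℕ → List ℕ → Set
ColInc _        []       = ⊤
ColInc []       (_ ∷ _)  = ⊥
ColInc (x ∷ r)  (y ∷ r') = x < y × ColInc r r'

Standard : Tableau → Set
Standard T =
  IsPartition (shape T) ×
  length (word T) ≡ sum (shape T) ×
  word T ↭ map suc (upTo (sum (shape T))) ×
  All (Linked _<_) (rows T) ×
  Linked ColInc (rows T)

pos : List ℕ → ℕ → ℕ
pos []      a = 0
pos (x ∷ w) a = if x ≡ᵇ a then 0 else suc (pos w a)

-- c w i  is  c_i  (for i ≥ 1):  c_1 = 0,
-- c_{i+1} = c_i + 1 if i+1 lies to the left of i in w, else c_i
c : List ℕ → ℕ → ℕ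
c w zero          = 0
c w (suc zero)    = 0
c w (suc (suc i)) = c w (suc i) + (if pos w (suc (suc i)) <ᵇ pos w (suc i) then 1 else 0)

cocharge : List ℕ → ℕ
cocharge w = sum (map (λ i → c w (suc i)) (upTo (length w)))

-- Polynomials in q, t, x_1..x_N with integer coefficients, as finite
-- lists of terms; two polynomials are equal iff all coefficients agree.

Mono : ℕ → Set
Mono N = ℕ × ℕ × Vec ℕ N          -- (exponent of q, exponent of t, exponents of x)

Poly : ℕ → Set
Poly N = List (ℤ × Mono N)

eqMono : ∀ {N} → Mono N → Mono N → Bool
eqMono (a , b , e) (a' , b' , e') =
  does (a ≟ℕ a') ∧ does (b ≟ℕ b') ∧ does (≡-dec _≟ℕ_ e e')

coeff : ∀ {N} → Poly N → Mono N → ℤ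
coeff []              m = + 0
coeff ((z , m') ∷ p)  m = (if eqMono m' m then z else + 0) +ℤ coeff p m

_≈P_ : ∀ {N} → Poly N → Poly N → Set
p ≈P p' = ∀ m → coeff p m ≡ coeff p' m

qpow* : ∀ {N} → ℕ → Poly N → Poly N
qpow* k = map (λ { (z , (a , b , e)) → (z , (k + a , b , e)) })

-- S_λ[X^t] with X^t = (x_1+…+x_N)(t-1) = tX − X, via super-tableaux:
-- S_λ[A − B] = Σ over fillings of λ by letters b̄ (from B) < a (from A),
-- unbarred letters weakly increasing in rows / strictly in columns,
-- barred letters strictly increasing in rows / weakly in columns,
-- weight Π (t x_i) over unbarred i, Π (−x_i) over barred i.

data Letter (N : ℕ) : Set where
  bar   : Fin N → Letter N
  unbar : Fin N → Letter N

letters : (N : ℕ) → List (Letter N)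
letters N = map bar (allFin N) ++ map unbar (allFin N)

ltF : ∀ {N} → Fin N → Fin N → Bool
ltF i j = Data.Fin.toℕ i <ᵇ Data.Fin.toℕ j

eqF : ∀ {N} → Fin N → Fin N → Bool
eqF i j = does (i ≟F j)

rowOK : ∀ {N} → Letter N → Letter N → Bool
rowOK (bar i)   (bar j)   = ltF i j
rowOK (bar i)   (unbar j) = true
rowOK (unbar i) (bar j)   = false
rowOK (unbar i) (unbar j) = ltF i j ∨ eqF i j

colOK : ∀ {N} → Letter N → Letter N → Bool
colOK (bar i)   (bar j)   = ltF i j ∨ eqF i j
colOK (bar i)   (unbar j) = true
colOK (unbar i) (bar j)   = false
colOK (unbar i) (unbar j) = ltF i j

rowCheck : ∀ {N} → List (Letter N) → Bool
rowCheck []            = true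
rowCheck (x ∷ [])      = true
rowCheck (x ∷ y ∷ r)   = rowOK x y ∧ rowCheck (y ∷ r)

colPair : ∀ {N} → List (Letter N) → List (Letter N) → Bool
colPair _       []       = true
colPair []      (_ ∷ _)  = false
colPair (x ∷ r) (y ∷ r') = colOK x y ∧ colPair r r'

colCheck : ∀ {N} → List (List (Letter N)) → Bool
colCheck []              = true
colCheck (r ∷ [])        = true
colCheck (r ∷ r' ∷ rs)   = colPair r r' ∧ colCheck (r' ∷ rs)

allCheck : ∀ {N} → List (List (Letter N)) → Bool
allCheck F = foldr (λ r b → rowCheck r ∧ b) true F ∧ colCheck F

wordsOfLength : (N : ℕ) → ℕ → List (List (Letter N))
wordsOfLength N zero    = [] ∷ []
wordsOfLength N (suc k) = concatMap (λ x → map (x ∷_) (wordsOfLength N k)) (letters N)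

fillings : (N : ℕ) → List ℕ → List (List (List (Letter N)))
fillings N []       = [] ∷ []
fillings N (l ∷ ls) = concatMap (λ r → map (r ∷_) (fillings N ls)) (wordsOfLength N l)

letterWeight : ∀ {N} → Letter N → ℤ × Mono N → ℤ × Mono N
letterWeight (bar i)   (z , a , b , e) = (- z , a , b , updateAt e i suc)
letterWeight (unbar i) (z , a , b , e) = (z , a , suc b , updateAt e i suc)

fillingWeight : ∀ {N} → List (List (Letter N)) → ℤ × Mono N
fillingWeight {N} F = foldr letterWeight (+ 1 , 0 , 0 , replicate N 0) (Data.List.concat F)

SXt : (N : ℕ) → List ℕ → Poly N
SXt N la = map fillingWeight (boolFilter allCheck (fillings N la))

digamma : (N : ℕ) → Tableau → Poly N
digamma N T = qpow* (cocharge (word T)) (SXt N (shape T))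

-- pair types D_j(a),  j ∈ {1,2,3,4} encoded as Fin 4 (zero ↦ 1, …)

D : Fin 4 → ℕ → List ℕ × List ℕ
D zero                   a = let b = a + 1 ; c = a + 2 ; d = a + 3 in (b ∷ a ∷ c ∷ d ∷ [] , c ∷ a ∷ b ∷ d ∷ [])
D (suc zero)             a = let b = a + 1 ; c = a + 2 ; d = a + 3 in (d ∷ b ∷ a ∷ c ∷ [] , d ∷ c ∷ a ∷ b ∷ [])
D (suc (suc zero))       a = let b = a + 1 ; c = a + 2 ; d = a + 3 in (a ∷ c ∷ d ∷ b ∷ [] , a ∷ b ∷ d ∷ c ∷ [])
D (suc (suc (suc zero))) a = let b = a + 1 ; c = a + 2 ; d = a + 3 in (c ∷ d ∷ b ∷ a ∷ [] , b ∷ d ∷ c ∷ a ∷ [])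

restrict : ℕ → List ℕ → List ℕ
restrict a = boolFilter (λ x → (a ℕ.≤ᵇ x) ∧ (x <ᵇ a + 4))

swapLetter : ℕ → ℕ → ℕ → ℕ
swapLetter b c x = if x ≡ᵇ b then c else (if x ≡ᵇ c then b else x)

IsPairType : Fin 4 → ℕ → Tableau → Tableau → Set
IsPairType j a T₁ T₂ =
  shape T₁ ≡ shape T₂ ×
  word T₁ ≡ map (swapLetter (a + 1) (a + 2)) (word T₂) ×
  restrict a (word T₁) ≡ proj₁ (D j a) ×
  restrict a (word T₂) ≡ proj₂ (D j a)

{-# OPTIONS --safe #-}
-- Swapping b = a+1 and c = a+2 changes whether k+1 lies left of k only for k ∈ {a, b, c}, and
-- there the answer is read off the restrictions D_j(a). Since c_{k+1} − c_k records exactly that,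
-- checking the four patterns shows that the sequence c_k of T exceeds that of T' by one at a single
-- index and agrees with it elsewhere, so cocharge T = cocharge T' + 1 while the shapes agree.
-- Standardness of T' only places that index and a in 1..n.
module Submission where

open import Defs
open import Data.Nat using (ℕ; zero; suc; _+_; _∸_; _≤_; _<_; _≡ᵇ_; _<ᵇ_; _≤ᵇ_; s≤s; z≤n)
open import Data.Nat.Properties
open import Data.Nat.ListAction using (sum)
open import Data.Fin using (Fin; zero; suc)
open import Data.Bool using (Bool; true; false; if_then_else_; _∧_)
open import Data.List using (List; []; _∷_; map; applyUpTo; upTo; length)
open import Data.List.Properties using (map-upTo; length-map; map-∘)
open import Data.List.Membership.Propositional using (_∈_)
open import Data.List.Membership.Propositional.Properties using (∈-map⁺; ∈-map⁻; ∈-upTo⁻)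
open import Data.List.Relation.Binary.Permutation.Propositional.Properties using (∈-resp-↭)
open import Data.List.Relation.Unary.Any using (here; there)
open import Data.Product using (_×_; _,_; proj₁; proj₂)
open import Data.Sum using (_⊎_; inj₁; inj₂)
open import Function using (_∘_)
open import Relation.Nullary using (yes; no)
open import Relation.Nullary.Decidable using (dec-true; dec-false)
open import Relation.Binary.PropositionalEquality
open ≡-Reasoning

-- Written as in the definition of c, so that c w (2 + k) unfolds to c w (1 + k) + bit (descent w (1 + k)).
bit : Bool → ℕ
bit b = if b then 1 else 0

≡⇒≡ᵇ≡true : ∀ {m n} → m ≡ n → (m ≡ᵇ n) ≡ true
≡⇒≡ᵇ≡true {m} {n} = dec-true (m ≟ n)

≢⇒≡ᵇ≡false : ∀ {m n} → m ≢ n → (m ≡ᵇ n) ≡ false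
≢⇒≡ᵇ≡false {m} {n} = dec-false (m ≟ n)

≡ᵇ-+ʳ : ∀ a m n → (m + a ≡ᵇ n + a) ≡ (m ≡ᵇ n)
≡ᵇ-+ʳ a m n rewrite +-comm m a | +-comm n a = cancel a
  where
  cancel : ∀ a → (a + m ≡ᵇ a + n) ≡ (m ≡ᵇ n)
  cancel zero    = refl
  cancel (suc a) = cancel a

swapLetter-≡ᵇ : ∀ {b c x} z → x ≢ b → x ≢ c → (swapLetter b c z ≡ᵇ x) ≡ (z ≡ᵇ x)
swapLetter-≡ᵇ {b} {c} z x≢b x≢c with z ≟ b
... | yes refl rewrite ≡⇒≡ᵇ≡true {z} refl
                     | ≢⇒≡ᵇ≡false (x≢c ∘ sym) | ≢⇒≡ᵇ≡false (x≢b ∘ sym) = refl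
... | no z≢b with z ≟ c
...   | yes refl rewrite ≢⇒≡ᵇ≡false z≢b | ≡⇒≡ᵇ≡true {z} refl
                       | ≢⇒≡ᵇ≡false (x≢b ∘ sym) | ≢⇒≡ᵇ≡false (x≢c ∘ sym) = refl
...   | no z≢c rewrite ≢⇒≡ᵇ≡false z≢b | ≢⇒≡ᵇ≡false z≢c = refl

pos-map : ∀ (f : ℕ → ℕ) w {x y} → (∀ z → (f z ≡ᵇ x) ≡ (z ≡ᵇ y)) → pos (map f w) x ≡ pos w y
pos-map f []      _    = refl
pos-map f (z ∷ w) {y = y} f≡ᵇ rewrite f≡ᵇ z with z ≡ᵇ y
... | true  = refl
... | false = cong suc (pos-map f w f≡ᵇ)

pos-map-+ : ∀ {a} w x → pos (map (_+ a) w) (x + a) ≡ pos w x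
pos-map-+ {a} w x = pos-map (_+ a) w (λ z → ≡ᵇ-+ʳ a z x)

pos-map-swapLetter : ∀ {b c x} w → x ≢ b → x ≢ c → pos (map (swapLetter b c) w) x ≡ pos w x
pos-map-swapLetter w x≢b x≢c = pos-map _ w (λ z → swapLetter-≡ᵇ z x≢b x≢c)

∈-boolFilter⁻ : ∀ (p : ℕ → Bool) w {x} → x ∈ boolFilter p w → x ∈ w
∈-boolFilter⁻ p (z ∷ w) x∈ with p z
∈-boolFilter⁻ p (z ∷ w) (here x≡z)  | true = here x≡z
∈-boolFilter⁻ p (z ∷ w) (there x∈)  | true = there (∈-boolFilter⁻ p w x∈)
∈-boolFilter⁻ p (z ∷ w) x∈          | false = there (∈-boolFilter⁻ p w x∈)

rejected≢kept : ∀ (p : ℕ → Bool) {u v} → p u ≡ false → p v ≡ true → u ≢ v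
rejected≢kept p pu pv refl with () ← trans (sym pu) pv

pos-boolFilter-<ᵇ : ∀ (p : ℕ → Bool) w {x y} → p x ≡ true → p y ≡ true →
  (pos (boolFilter p w) x <ᵇ pos (boolFilter p w) y) ≡ (pos w x <ᵇ pos w y)
pos-boolFilter-<ᵇ p []      _  _  = refl
pos-boolFilter-<ᵇ p (z ∷ w) {x} {y} px py with p z in pz
... | true with z ≡ᵇ x | z ≡ᵇ y
...   | true  | true  = refl
...   | true  | false = refl
...   | false | true  = refl
...   | false | false = pos-boolFilter-<ᵇ p w px py
pos-boolFilter-<ᵇ p (z ∷ w) {x} {y} px py | false
  rewrite ≢⇒≡ᵇ≡false (rejected≢kept p pz px) | ≢⇒≡ᵇ≡false (rejected≢kept p pz py) =
  pos-boolFilter-<ᵇ p w px py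

descent : List ℕ → ℕ → Bool
descent w k = pos w (suc k) <ᵇ pos w k

-- The hypothesis is the difference of the conclusion at k + 1 and k, stated without subtraction.
c-+-indicator : ∀ w w' {m} → 2 ≤ m →
  (∀ k → bit (k ≡ᵇ m) + bit (descent w k) ≡ bit (descent w' k) + bit (suc k ≡ᵇ m)) →
  ∀ k → c w k ≡ c w' k + bit (k ≡ᵇ m)
c-+-indicator w w' (s≤s (s≤s _)) balance zero          = refl
c-+-indicator w w' (s≤s (s≤s _)) balance (suc zero)    = refl
c-+-indicator w w' {m} 2≤m balance (suc (suc k)) = begin
  c w (suc k) + bit (descent w (suc k))
    ≡⟨ cong (_+ bit (descent w (suc k))) (c-+-indicator w w' 2≤m balance (suc k)) ⟩
  c w' (suc k) + bit (suc k ≡ᵇ m) + bit (descent w (suc k))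
    ≡⟨ +-assoc (c w' (suc k)) _ _ ⟩
  c w' (suc k) + (bit (suc k ≡ᵇ m) + bit (descent w (suc k)))
    ≡⟨ cong (c w' (suc k) +_) (balance (suc k)) ⟩
  c w' (suc k) + (bit (descent w' (suc k)) + bit (suc (suc k) ≡ᵇ m))
    ≡⟨ +-assoc (c w' (suc k)) _ _ ⟨
  c w' (suc (suc k)) + bit (suc (suc k) ≡ᵇ m) ∎

sum-applyUpTo-cong : ∀ {f g : ℕ → ℕ} n → (∀ k → f k ≡ g k) →
  sum (applyUpTo f n) ≡ sum (applyUpTo g n)
sum-applyUpTo-cong zero    _   = refl
sum-applyUpTo-cong (suc n) f≗g = cong₂ _+_ (f≗g 0) (sum-applyUpTo-cong n (f≗g ∘ suc))

sum-applyUpTo-+-indicator : ∀ {f g : ℕ → ℕ} {m} n → m < n → (∀ k → f k ≡ g k + bit (k ≡ᵇ m)) →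
  sum (applyUpTo f n) ≡ suc (sum (applyUpTo g n))
sum-applyUpTo-+-indicator {f} {g} {zero} (suc n) _ f≗g = begin
  f 0 + sum (applyUpTo (f ∘ suc) n)
    ≡⟨ cong₂ _+_ (f≗g 0) (sum-applyUpTo-cong n (λ k → trans (f≗g (suc k)) (+-identityʳ _))) ⟩
  g 0 + 1 + sum (applyUpTo (g ∘ suc) n)
    ≡⟨ cong (_+ sum (applyUpTo (g ∘ suc) n)) (+-comm (g 0) 1) ⟩
  suc (g 0 + sum (applyUpTo (g ∘ suc) n)) ∎
sum-applyUpTo-+-indicator {f} {g} {suc m} (suc n) (s≤s m<n) f≗g = begin
  f 0 + sum (applyUpTo (f ∘ suc) n)
    ≡⟨ cong₂ _+_ (trans (f≗g 0) (+-identityʳ _)) (sum-applyUpTo-+-indicator n m<n (f≗g ∘ suc)) ⟩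
  g 0 + suc (sum (applyUpTo (g ∘ suc) n))
    ≡⟨ +-suc (g 0) _ ⟩
  suc (g 0 + sum (applyUpTo (g ∘ suc) n)) ∎

cocharge-+-indicator : ∀ w w' {m} → length w ≡ length w' → 1 ≤ m → m ≤ length w' →
  (∀ k → c w k ≡ c w' k + bit (k ≡ᵇ m)) → cocharge w ≡ suc (cocharge w')
cocharge-+-indicator w w' len (s≤s z≤n) m≤n c≡ = begin
  sum (map (λ k → c w (suc k)) (upTo (length w)))
    ≡⟨ cong sum (map-upTo _ (length w)) ⟩
  sum (applyUpTo (λ k → c w (suc k)) (length w))
    ≡⟨ cong (λ n → sum (applyUpTo (λ k → c w (suc k)) n)) len ⟩
  sum (applyUpTo (λ k → c w (suc k)) (length w'))
    ≡⟨ sum-applyUpTo-+-indicator (length w') m≤n (c≡ ∘ suc) ⟩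
  suc (sum (applyUpTo (λ k → c w' (suc k)) (length w')))
    ≡⟨ cong (suc ∘ sum) (map-upTo _ (length w')) ⟨
  suc (cocharge w') ∎

Outside : ℕ → ℕ → Set
Outside a k = k < a ⊎ 3 + a ≤ k

data Window (a : ℕ) : ℕ → Set where
  outside : ∀ {k} → Outside a k → Window a k
  within  : ∀ l → l < 3 → Window a (l + a)

window : ∀ a k → Window a k
window a k with k <? a | 3 + a ≤? k
... | yes k<a | _         = outside (inj₁ k<a)
... | no _    | yes 3+a≤k = outside (inj₂ 3+a≤k)
... | no k≮a  | no 3+a≰k  =
  subst (Window a) (m∸n+n≡m (≮⇒≥ k≮a))
        (within (k ∸ a) (m<n+o⇒m∸n<o k a (subst (k <_) (+-comm 3 a) (≰⇒> 3+a≰k))))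

outside-≢ : ∀ {a k l} → Outside a k → 1 ≤ l → l ≤ 2 → k ≢ l + a × suc k ≢ l + a
outside-≢ {a} {k} {l} (inj₁ k<a) 1≤l _ =
  <⇒≢ (<-≤-trans k<a (m≤n+m a l)) , <⇒≢ (≤-<-trans k<a (+-monoˡ-≤ a 1≤l))
outside-≢ {a} {k} {l} (inj₂ 3+a≤k) _ l≤2 = >⇒≢ l+a<k , >⇒≢ (m<n⇒m<1+n l+a<k)
  where
  l+a<k : l + a < k
  l+a<k = ≤-trans (s≤s (+-monoˡ-≤ a l≤2)) 3+a≤k

descent-swapLetter-outside : ∀ {a k} w → Outside a k →
  descent (map (swapLetter (a + 1) (a + 2)) w) k ≡ descent w k
descent-swapLetter-outside {a} {k} w o rewrite +-comm a 1 | +-comm a 2 =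
  cong₂ _<ᵇ_ (pos-map-swapLetter w (proj₂ b-clear) (proj₂ c-clear))
             (pos-map-swapLetter w (proj₁ b-clear) (proj₁ c-clear))
  where
  b-clear : k ≢ 1 + a × suc k ≢ 1 + a
  b-clear = outside-≢ o (s≤s z≤n) (s≤s z≤n)
  c-clear : k ≢ 2 + a × suc k ≢ 2 + a
  c-clear = outside-≢ o (s≤s z≤n) ≤-refl

restrict-keeps : ∀ a {x} → x < 4 → ((a ≤ᵇ x + a) ∧ (x + a <ᵇ a + 4)) ≡ true
restrict-keeps a {x} x<4 =
  cong₂ _∧_ (dec-true (a ≤? x + a) (m≤n+m a x))
            (dec-true (x + a <? a + 4) (subst (x + a <_) (+-comm 4 a) (+-monoˡ-< a x<4)))

descent-restrict : ∀ {a} w P {l} → restrict a w ≡ map (_+ a) P → l < 3 →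
  descent w (l + a) ≡ descent P l
descent-restrict {a} w P {l} r l<3 = begin
  pos w (suc l + a) <ᵇ pos w (l + a)
    ≡⟨ pos-boolFilter-<ᵇ _ w (restrict-keeps a (s≤s l<3)) (restrict-keeps a (m<n⇒m<1+n l<3)) ⟨
  pos (restrict a w) (suc l + a) <ᵇ pos (restrict a w) (l + a)
    ≡⟨ cong (λ v → pos v (suc l + a) <ᵇ pos v (l + a)) r ⟩
  pos (map (_+ a) P) (suc l + a) <ᵇ pos (map (_+ a) P) (l + a)
    ≡⟨ cong₂ _<ᵇ_ (pos-map-+ P (suc l)) (pos-map-+ P l) ⟩
  descent P l ∎

D-translate : ∀ j a → D j a ≡ (map (_+ a) (proj₁ (D j 0)) , map (_+ a) (proj₂ (D j 0)))
D-translate zero                   a rewrite +-comm a 1 | +-comm a 2 | +-comm a 3 = refl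
D-translate (suc zero)             a rewrite +-comm a 1 | +-comm a 2 | +-comm a 3 = refl
D-translate (suc (suc zero))       a rewrite +-comm a 1 | +-comm a 2 | +-comm a 3 = refl
D-translate (suc (suc (suc zero))) a rewrite +-comm a 1 | +-comm a 2 | +-comm a 3 = refl

-- For a pair of type D_j(a), c_k(T) = c_k(T') + 1 exactly at k = a + raisedLetter j.
raisedLetter : Fin 4 → ℕ
raisedLetter zero                   = 1
raisedLetter (suc zero)             = 1
raisedLetter (suc (suc zero))       = 2
raisedLetter (suc (suc (suc zero))) = 2

raisedLetter-bounds : ∀ j → 1 ≤ raisedLetter j × raisedLetter j ≤ 2
raisedLetter-bounds zero                   = s≤s z≤n , s≤s z≤n
raisedLetter-bounds (suc zero)             = s≤s z≤n , s≤s z≤n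
raisedLetter-bounds (suc (suc zero))       = s≤s z≤n , ≤-refl
raisedLetter-bounds (suc (suc (suc zero))) = s≤s z≤n , ≤-refl

D-letters : ∀ j → 0 ∈ proj₂ (D j 0) × raisedLetter j ∈ proj₂ (D j 0)
D-letters zero                   = there (here refl) , there (there (here refl))
D-letters (suc zero)             = there (there (here refl)) , there (there (there (here refl)))
D-letters (suc (suc zero))       = here refl , there (there (there (here refl)))
D-letters (suc (suc (suc zero))) = there (there (there (here refl))) , there (there (here refl))

D-descent-balance : ∀ j l → l < 3 →
  bit (l ≡ᵇ raisedLetter j) + bit (descent (proj₁ (D j 0)) l)
    ≡ bit (descent (proj₂ (D j 0)) l) + bit (suc l ≡ᵇ raisedLetter j)
D-descent-balance zero                   0 _ = refl
D-descent-balance zero                   1 _ = refl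
D-descent-balance zero                   2 _ = refl
D-descent-balance (suc zero)             0 _ = refl
D-descent-balance (suc zero)             1 _ = refl
D-descent-balance (suc zero)             2 _ = refl
D-descent-balance (suc (suc zero))       0 _ = refl
D-descent-balance (suc (suc zero))       1 _ = refl
D-descent-balance (suc (suc zero))       2 _ = refl
D-descent-balance (suc (suc (suc zero))) 0 _ = refl
D-descent-balance (suc (suc (suc zero))) 1 _ = refl
D-descent-balance (suc (suc (suc zero))) 2 _ = refl
D-descent-balance _ (suc (suc (suc _))) (s≤s (s≤s (s≤s ())))

pairType-descent-balance : ∀ {a} j w' →
  restrict a (map (swapLetter (a + 1) (a + 2)) w') ≡ proj₁ (D j a) →
  restrict a w' ≡ proj₂ (D j a) →
  ∀ k → bit (k ≡ᵇ raisedLetter j + a) + bit (descent (map (swapLetter (a + 1) (a + 2)) w') k)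
          ≡ bit (descent w' k) + bit (suc k ≡ᵇ raisedLetter j + a)
pairType-descent-balance {a} j w' r r' k with window a k | raisedLetter-bounds j
... | outside o | 1≤e , e≤2
  rewrite descent-swapLetter-outside w' o
        | ≢⇒≡ᵇ≡false (proj₁ (outside-≢ o 1≤e e≤2))
        | ≢⇒≡ᵇ≡false (proj₂ (outside-≢ o 1≤e e≤2))
  = sym (+-identityʳ _)
... | within l l<3 | _ = begin
  bit (l + a ≡ᵇ e + a) + bit (descent w (l + a))
    ≡⟨ cong₂ (λ x y → bit x + bit y) (≡ᵇ-+ʳ a l e) (descent-restrict w _ r₀ l<3) ⟩
  bit (l ≡ᵇ e) + bit (descent (proj₁ (D j 0)) l)
    ≡⟨ D-descent-balance j l l<3 ⟩
  bit (descent (proj₂ (D j 0)) l) + bit (suc l ≡ᵇ e)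
    ≡⟨ cong₂ (λ x y → bit x + bit y) (descent-restrict w' _ r₀' l<3) (≡ᵇ-+ʳ a (suc l) e) ⟨
  bit (descent w' (l + a)) + bit (suc l + a ≡ᵇ e + a) ∎
  where
  e : ℕ
  e = raisedLetter j
  w : List ℕ
  w = map (swapLetter (a + 1) (a + 2)) w'
  r₀ : restrict a w ≡ map (_+ a) (proj₁ (D j 0))
  r₀ = trans r (cong proj₁ (D-translate j a))
  r₀' : restrict a w' ≡ map (_+ a) (proj₂ (D j 0))
  r₀' = trans r' (cong proj₂ (D-translate j a))

standard-letter : ∀ {T x} → Standard T → x ∈ word T → 1 ≤ x × x ≤ length (word T)
standard-letter {T} (_ , len , perm , _) x∈w with ∈-map⁻ suc (∈-resp-↭ perm x∈w)
... | y , y∈ , refl = s≤s z≤n , subst (suc y ≤_) (sym len) (∈-upTo⁻ y∈)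

pairType-letter-bounds : ∀ {T T' a} j → Standard T' → IsPairType j a T T' →
  1 ≤ a × raisedLetter j + a ≤ length (word T')
pairType-letter-bounds {T' = T'} {a} j st' (_ , _ , _ , r') =
  proj₁ (bounds (proj₁ (D-letters j))) , proj₂ (bounds (proj₂ (D-letters j)))
  where
  bounds : ∀ {x} → x ∈ proj₂ (D j 0) → 1 ≤ x + a × x + a ≤ length (word T')
  bounds x∈ = standard-letter st' (∈-boolFilter⁻ _ (word T')
    (subst (_ ∈_) (sym (trans r' (cong proj₂ (D-translate j a)))) (∈-map⁺ (_+ a) x∈)))

cocharge-pairType : ∀ {T T' a} j → Standard T' → IsPairType j a T T' →
  cocharge (word T) ≡ suc (cocharge (word T'))
cocharge-pairType {tab _ _} {tab _ w'} {a} j st' pair@(_ , refl , r , r')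
  with pairType-letter-bounds j st' pair
... | 1≤a , m≤n =
  cocharge-+-indicator w w' (length-map _ w') (≤-trans 1≤a (m≤n+m a _)) m≤n
    (c-+-indicator w w' (+-mono-≤ (proj₁ (raisedLetter-bounds j)) 1≤a)
      (pairType-descent-balance j w' r r'))
  where
  w : List ℕ
  w = map (swapLetter (a + 1) (a + 2)) w'

qpow*-suc : ∀ {N} k (p : Poly N) → qpow* (suc k) p ≡ qpow* 1 (qpow* k p)
qpow*-suc k p = map-∘ p

lemma23 : (T T' : Tableau) (i : ℕ) (j : Fin 4) →
          Standard T → Standard T' → IsPairType j i T T' →
          (N : ℕ) → digamma N T ≈P qpow* 1 (digamma N T')
lemma23 T T' a j _ st' pair N m = cong (λ p → coeff p m) (begin
  qpow* (cocharge (word T)) (SXt N (shape T))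
    ≡⟨ cong₂ (λ k sh → qpow* k (SXt N sh)) (cocharge-pairType j st' pair) (proj₁ pair) ⟩
  qpow* (suc (cocharge (word T'))) (SXt N (shape T'))
    ≡⟨ qpow*-suc _ _ ⟩
  qpow* 1 (digamma N T') ∎)
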